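{- Let $p$ be a prime and $k$ a positive integer such that for every $k$-element subset $\mathcal{K}\subset\mathbb{Z}_p$, every element of $\mathbb{Z}_p$ is the sum of the elements of some subset of $\mathcal{K}$. Let $q=mp$ with $m>1$ an integer, and let $\mathcal{B}\subset\mathbb{Z}_q$ with $|\mathcal{B}|>4k$, the elements of $\mathcal{B}$ pairwise distinct modulo $p$, and not all elements of $\mathcal{B}$ multiples of $m$. Suppose in addition that there is no subset $\mathcal{A}\subset\mathcal{B}$ with $\Sigma(\mathcal{A})\equiv 0\pmod p$ and $\Sigma(\mathcal{A})\not\equiv0\pmod q$. If $\mathcal{V}_1,\mathcal{V}_2\subset\mathcal{B}$ satisfy $\Sigma(\mathcal{V}_1)\equiv\Sigma(\mathcal{V}_2)\pmod p$ but $\Sigma(\mathcal{V}_1)\not\equiv\Sigma(\mathcal{V}_2)\pmod q$, then $|\mathcal{V}_1\cup\mathcal{V}_2|>|\mathcal{B}|-k>3k$.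
   Context: $\mathbb{Z}_q=\mathbb{Z}/q\mathbb{Z}$; reduction modulo $p$ is the natural map $\mathbb{Z}_q\to\mathbb{Z}_p$. For a finite set $\mathcal{A}$, $\Sigma(\mathcal{A})=\sum_{a\in\mathcal{A}}a$. -}

module Defs where

open import Data.Nat using (ℕ; zero; suc; _+_; _*_)
open import Data.Fin using (Fin; toℕ)
open import Data.Fin.Subset using (Subset; Side; inside; outside)
open import Data.Vec using (lookup)
open import Data.List using (allFin; map)
open import Data.Nat.ListAction using (sum)
open import Data.Product using (∃₂)
open import Relation.Binary.PropositionalEquality using (_≡_)

-- Σ(𝒜): the sum of the elements of a subset 𝒜 ⊆ ℤ_n, where each element
-- of ℤ_n = Fin n is represented by its canonical representative in {0,…,n-1}.
-- The result is a natural number; it is only ever used up to congruence.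
Σ : ∀ {n} → Subset n → ℕ
Σ {n} A = sum (map (λ i → term (lookup A i) i) (allFin n))
  where
  term : Side → Fin n → ℕ
  term inside  i = toℕ i
  term outside i = 0

_≡_[mod_] : ℕ → ℕ → ℕ → Set
a ≡ b [mod n ] = ∃₂ λ x y → a + x * n ≡ b + y * n

-- If at most ∣B∣ − k elements of B lie in V₁ ∪ V₂, choose k of the remaining
-- ones.  Being distinct mod p, their residues form a k-subset of ℤ_p, so some
-- subset A of them has Σ A ≡ −Σ V₁ ≡ −Σ V₂ (mod p).  Then A ∪ V₁ and A ∪ V₂
-- are subsets of B with sum 0 mod p, hence with sum 0 mod q, and cancelling
-- Σ A gives Σ V₁ ≡ Σ V₂ (mod q).
module Submission where

open import Defs
open import Data.Nat using (ℕ; _+_; _*_; _∸_; _<_; _≤_)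
open import Data.Nat.Primality using (Prime)
open import Data.Nat.Divisibility using (_∣_)
open import Data.Fin using (Fin; toℕ)
open import Data.Fin.Subset using (Subset; _∈_; _⊆_; _∪_; ∣_∣)
open import Data.Product using (_×_; ∃-syntax)
open import Relation.Binary.PropositionalEquality using (_≡_; _≢_)
open import Relation.Nullary using (¬_)

open import Data.Bool using (if_then_else_)
open import Data.Empty using (⊥-elim)
open import Data.Fin using (zero; suc; _≟_)
open import Data.Fin.Properties using (suc-injective; 0≢1+n; toℕ-fromℕ<)
open import Data.Fin.Subset using (inside; outside; _∉_; _∩_; ∁; ⁅_⁆)
  renaming (⊥ to ∅)
open import Data.Fin.Subset.Properties
  using (_∈?_; ∉⊥; x∈⁅x⁆; x∈⁅y⁆⇒x≡y; x∈p∪q⁺; x∈p∪q⁻; x∈p∩q⁺; x∈p∩q⁻;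
         p∩q⊆p; p∩q⊆q; p⊆p∪q; q⊆p∪q; x∈∁p⇒x∉p; x∉p⇒x∈∁p; ⊆-min; ⊆-trans; ⊆-antisym;
         p⊆q⇒∣p∣≤∣q∣; s⊆s; ∣⊥∣≡0)
import Data.List as List
open import Data.List.Properties using (map-tabulate; tabulate-cong)
open import Data.Nat using (NonZero; zero; suc; s≤s)
open import Data.Nat.DivMod using (_%_; _/_; _mod_; m≡m%n+[m/n]*n; m%n<n)
open import Data.Nat.ListAction using (sum)
open import Data.Nat.Primality using (prime⇒nonZero)
open import Data.Nat.Properties
  using (+-assoc; +-comm; +-identityʳ; +-cancelˡ-≡; +-cancelˡ-≤; <⇒≤; ≤-trans;
         m≤m+n; m∸n+n≡m; m+n≤o⇒m≤o∸n; m≤o∸n⇒m+n≤o; ≮⇒≥; _<?_;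
         +-commutativeSemigroup; module ≤-Reasoning)
open import Data.Nat.Tactic.RingSolver using (solve-∀)
open import Data.Product using (_,_; proj₂; map; map₁)
open import Data.Sum using (inj₁; inj₂; [_,_]′)
open import Data.Vec using ([]; _∷_; lookup; tabulate; here; there)
open import Data.Vec.Properties using (lookup∘tabulate; []=⇒lookup; lookup⇒[]=)
open import Function using (_∘_; const)
open import Level using (0ℓ)
open import Relation.Binary.Bundles using (Setoid)
open import Relation.Binary.PropositionalEquality
  using (refl; sym; trans; cong; cong₂; subst; module ≡-Reasoning)
import Relation.Binary.Reasoning.Setoid as SetoidReasoning
open import Algebra.Properties.CommutativeSemigroup +-commutativeSemigroup using (x∙yz≈y∙xz)
open import Relation.Nullary using (yes; no)
open import Relation.Nullary.Decidable using (decidable-stable)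

≡mod-refl : ∀ {a n} → a ≡ a [mod n ]
≡mod-refl = 0 , 0 , refl

≡mod-sym : ∀ {a b n} → a ≡ b [mod n ] → b ≡ a [mod n ]
≡mod-sym (x , y , e) = y , x , sym e

≡mod-trans : ∀ {a b c n} → a ≡ b [mod n ] → b ≡ c [mod n ] → a ≡ c [mod n ]
≡mod-trans {a} {b} {c} {n} (x , y , e) (z , w , f) = x + z , y + w , (begin
  a + (x + z) * n    ≡⟨ split a x z n ⟩
  a + x * n + z * n  ≡⟨ cong (_+ z * n) e ⟩
  b + y * n + z * n  ≡⟨ swap b (y * n) (z * n) ⟩
  b + z * n + y * n  ≡⟨ cong (_+ y * n) f ⟩
  c + w * n + y * n  ≡⟨ swap c (w * n) (y * n) ⟩
  c + y * n + w * n  ≡⟨ split c y w n ⟨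
  c + (y + w) * n    ∎)
  where
  open ≡-Reasoning
  split : ∀ a x z n → a + (x + z) * n ≡ a + x * n + z * n
  split = solve-∀
  swap : ∀ a u v → a + u + v ≡ a + v + u
  swap = solve-∀

≡⇒≡mod : ∀ {a b n} → a ≡ b → a ≡ b [mod n ]
≡⇒≡mod refl = ≡mod-refl

≡mod-setoid : ℕ → Setoid 0ℓ 0ℓ
≡mod-setoid n = record
  { Carrier       = ℕ
  ; _≈_           = λ a b → a ≡ b [mod n ]
  ; isEquivalence = record { refl = ≡mod-refl ; sym = ≡mod-sym ; trans = ≡mod-trans }
  }

module ≡mod-Reasoning (n : ℕ) = SetoidReasoning (≡mod-setoid n)

+-cong-mod : ∀ {a b c d n} → a ≡ b [mod n ] → c ≡ d [mod n ] → (a + c) ≡ (b + d) [mod n ]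
+-cong-mod {a} {b} {c} {d} {n} (x , y , e) (z , w , f) = x + z , y + w , (begin
  a + c + (x + z) * n      ≡⟨ regroup a c x z n ⟩
  a + x * n + (c + z * n)  ≡⟨ cong₂ _+_ e f ⟩
  b + y * n + (d + w * n)  ≡⟨ regroup b d y w n ⟨
  b + d + (y + w) * n      ∎)
  where
  open ≡-Reasoning
  regroup : ∀ a c x z n → a + c + (x + z) * n ≡ a + x * n + (c + z * n)
  regroup = solve-∀

+-cancelˡ-mod : ∀ a {b c n} → (a + b) ≡ (a + c) [mod n ] → b ≡ c [mod n ]
+-cancelˡ-mod a {b} {c} (x , y , e) =
  x , y , +-cancelˡ-≡ a _ _ (trans (sym (+-assoc a b _)) (trans e (+-assoc a c _)))

m≡m%n-mod : ∀ a n .{{_ : NonZero n}} → a ≡ a % n [mod n ]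
m≡m%n-mod a n = 0 , a / n , trans (+-identityʳ a) (m≡m%n+[m/n]*n a n)

n≡0-mod : ∀ n → n ≡ 0 [mod n ]
n≡0-mod n = 0 , 1 , refl

additive-inverse-mod : ∀ p .{{_ : NonZero p}} a → ∃[ x ] ((toℕ x + a) ≡ 0 [mod p ])
additive-inverse-mod p a = (p ∸ a % p) mod p , (begin
  toℕ ((p ∸ a % p) mod p) + a  ≡⟨ cong (_+ a) (toℕ-fromℕ< _) ⟩
  (p ∸ a % p) % p + a          ≈⟨ +-cong-mod (≡mod-sym (m≡m%n-mod (p ∸ a % p) p)) (m≡m%n-mod a p) ⟩
  p ∸ a % p + a % p            ≡⟨ m∸n+n≡m (<⇒≤ (m%n<n a p)) ⟩
  p                            ≈⟨ n≡0-mod p ⟩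
  0                            ∎)
  where open ≡mod-Reasoning p

sumOver : ∀ {n} → Subset n → (Fin n → ℕ) → ℕ
sumOver []            g = 0
sumOver (inside  ∷ S) g = g zero + sumOver S (g ∘ suc)
sumOver (outside ∷ S) g = sumOver S (g ∘ suc)

∣p∣≡sumOver-1 : ∀ {n} (S : Subset n) → ∣ S ∣ ≡ sumOver S (const 1)
∣p∣≡sumOver-1 []            = refl
∣p∣≡sumOver-1 (inside  ∷ S) = cong suc (∣p∣≡sumOver-1 S)
∣p∣≡sumOver-1 (outside ∷ S) = ∣p∣≡sumOver-1 S

sum-tabulate-if≡sumOver : ∀ {n} (S : Subset n) (g : Fin n → ℕ) →
  sum (List.tabulate (λ i → if lookup S i then g i else 0)) ≡ sumOver S g
sum-tabulate-if≡sumOver []            g = refl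
sum-tabulate-if≡sumOver (inside  ∷ S) g = cong (g zero +_) (sum-tabulate-if≡sumOver S (g ∘ suc))
sum-tabulate-if≡sumOver (outside ∷ S) g = sum-tabulate-if≡sumOver S (g ∘ suc)

mutual
  Σ≡sumOver : ∀ {n} (A : Subset n) → Σ A ≡ sumOver A toℕ
  Σ≡sumOver A = trans (cong sum (trans (map-tabulate (λ i → i) _) (tabulate-cong (Σ-summand A))))
                      (sum-tabulate-if≡sumOver A toℕ)

  -- The left-hand side is the summand local to Defs.Σ, which cannot be named
  -- here; it is solved from the use above before the with-abstraction.
  Σ-summand : ∀ {n} (A : Subset n) i → _ ≡ (if lookup A i then toℕ i else 0)
  Σ-summand A i with lookup A i
  ... | inside  = refl
  ... | outside = refl

sumOver-cong-mod : ∀ {n q} (S : Subset n) {g h : Fin n → ℕ} →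
  (∀ i → g i ≡ h i [mod q ]) → sumOver S g ≡ sumOver S h [mod q ]
sumOver-cong-mod []            g≡h = ≡mod-refl
sumOver-cong-mod (inside  ∷ S) g≡h = +-cong-mod (g≡h zero) (sumOver-cong-mod S (g≡h ∘ suc))
sumOver-cong-mod (outside ∷ S) g≡h = sumOver-cong-mod S (g≡h ∘ suc)

sumOver-∅ : ∀ n (g : Fin n → ℕ) → sumOver (∅ {n}) g ≡ 0
sumOver-∅ zero    g = refl
sumOver-∅ (suc n) g = sumOver-∅ n (g ∘ suc)

sumOver-⁅⁆ : ∀ {n} (a : Fin n) (g : Fin n → ℕ) → sumOver ⁅ a ⁆ g ≡ g a
sumOver-⁅⁆ zero    g = trans (cong (g zero +_) (sumOver-∅ _ (g ∘ suc))) (+-identityʳ (g zero))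
sumOver-⁅⁆ (suc a) g = sumOver-⁅⁆ a (g ∘ suc)

Disjoint : ∀ {n} → Subset n → Subset n → Set
Disjoint X Y = ∀ {i} → i ∈ X → i ∉ Y

drop-∷-Disjoint : ∀ {n s t} {X Y : Subset n} → Disjoint (s ∷ X) (t ∷ Y) → Disjoint X Y
drop-∷-Disjoint X#Y i∈X i∈Y = X#Y (there i∈X) (there i∈Y)

sumOver-∪ : ∀ {n} {X Y : Subset n} (g : Fin n → ℕ) → Disjoint X Y →
  sumOver (X ∪ Y) g ≡ sumOver X g + sumOver Y g
sumOver-∪ {X = []}          {[]}          g X#Y = refl
sumOver-∪ {X = inside  ∷ X} {inside  ∷ Y} g X#Y = ⊥-elim (X#Y here here)
sumOver-∪ {X = inside  ∷ X} {outside ∷ Y} g X#Y =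
  trans (cong (g zero +_) (sumOver-∪ (g ∘ suc) (drop-∷-Disjoint X#Y))) (sym (+-assoc (g zero) _ _))
sumOver-∪ {X = outside ∷ X} {inside  ∷ Y} g X#Y =
  trans (cong (g zero +_) (sumOver-∪ (g ∘ suc) (drop-∷-Disjoint X#Y)))
        (x∙yz≈y∙xz (g zero) (sumOver X (g ∘ suc)) (sumOver Y (g ∘ suc)))
sumOver-∪ {X = outside ∷ X} {outside ∷ Y} g X#Y = sumOver-∪ (g ∘ suc) (drop-∷-Disjoint X#Y)

∣∪∣-disjoint : ∀ {n} {X Y : Subset n} → Disjoint X Y → ∣ X ∪ Y ∣ ≡ ∣ X ∣ + ∣ Y ∣
∣∪∣-disjoint {X = X} {Y} X#Y = begin
  ∣ X ∪ Y ∣                                    ≡⟨ ∣p∣≡sumOver-1 (X ∪ Y) ⟩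
  sumOver (X ∪ Y) (const 1)                    ≡⟨ sumOver-∪ (const 1) X#Y ⟩
  sumOver X (const 1) + sumOver Y (const 1)    ≡⟨ cong₂ _+_ (∣p∣≡sumOver-1 X) (∣p∣≡sumOver-1 Y) ⟨
  ∣ X ∣ + ∣ Y ∣                                ∎
  where open ≡-Reasoning

Σ-∪ : ∀ {n} {X Y : Subset n} → Disjoint X Y → Σ (X ∪ Y) ≡ Σ X + Σ Y
Σ-∪ {X = X} {Y} X#Y = begin
  Σ (X ∪ Y)                      ≡⟨ Σ≡sumOver (X ∪ Y) ⟩
  sumOver (X ∪ Y) toℕ            ≡⟨ sumOver-∪ toℕ X#Y ⟩
  sumOver X toℕ + sumOver Y toℕ  ≡⟨ cong₂ _+_ (Σ≡sumOver X) (Σ≡sumOver Y) ⟨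
  Σ X + Σ Y                      ∎
  where open ≡-Reasoning

∣p∣≤∣q∣+∣p∩∁q∣ : ∀ {n} (P Q : Subset n) → ∣ P ∣ ≤ ∣ Q ∣ + ∣ P ∩ ∁ Q ∣
∣p∣≤∣q∣+∣p∩∁q∣ P Q = begin
  ∣ P ∣                ≤⟨ p⊆q⇒∣p∣≤∣q∣ covered ⟩
  ∣ Q ∪ (P ∩ ∁ Q) ∣    ≡⟨ ∣∪∣-disjoint disjoint ⟩
  ∣ Q ∣ + ∣ P ∩ ∁ Q ∣  ∎
  where
  open ≤-Reasoning
  covered : P ⊆ Q ∪ (P ∩ ∁ Q)
  covered {i} i∈P with i ∈? Q
  ... | yes i∈Q = x∈p∪q⁺ (inj₁ i∈Q)
  ... | no  i∉Q = x∈p∪q⁺ (inj₂ (x∈p∩q⁺ (i∈P , x∉p⇒x∈∁p i∉Q)))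
  disjoint : Disjoint Q (P ∩ ∁ Q)
  disjoint i∈Q i∈P∩∁Q = x∈∁p⇒x∉p (proj₂ (x∈p∩q⁻ P (∁ Q) i∈P∩∁Q)) i∈Q

∣q∣≤∣p∣∸k⇒k≤∣p∩∁q∣ : ∀ {n k} (P Q : Subset n) → k ≤ ∣ P ∣ → ∣ Q ∣ ≤ ∣ P ∣ ∸ k → k ≤ ∣ P ∩ ∁ Q ∣
∣q∣≤∣p∣∸k⇒k≤∣p∩∁q∣ {k = k} P Q k≤∣P∣ ∣Q∣≤∣P∣∸k = +-cancelˡ-≤ ∣ Q ∣ k _ (begin
  ∣ Q ∣ + k            ≤⟨ m≤o∸n⇒m+n≤o ∣ Q ∣ k≤∣P∣ ∣Q∣≤∣P∣∸k ⟩
  ∣ P ∣                ≤⟨ ∣p∣≤∣q∣+∣p∩∁q∣ P Q ⟩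
  ∣ Q ∣ + ∣ P ∩ ∁ Q ∣  ∎)
  where open ≤-Reasoning

⊆-of-size : ∀ {n} k (S : Subset n) → k ≤ ∣ S ∣ → ∃[ T ] (T ⊆ S × ∣ T ∣ ≡ k)
⊆-of-size {n} zero    S             _         = ∅ , ⊆-min S , ∣⊥∣≡0 n
⊆-of-size (suc k) (inside  ∷ S) (s≤s k≤S) = map (inside ∷_) (map s⊆s (cong suc)) (⊆-of-size k S k≤S)
⊆-of-size (suc k) (outside ∷ S) k<S       = map (outside ∷_) (map₁ s⊆s) (⊆-of-size (suc k) S k<S)

image : ∀ {n p} → (Fin n → Fin p) → Subset n → Subset p
image f []            = ∅
image f (inside  ∷ S) = ⁅ f zero ⁆ ∪ image (f ∘ suc) S
image f (outside ∷ S) = image (f ∘ suc) S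

∈-image⁺ : ∀ {n p} (f : Fin n → Fin p) {S i} → i ∈ S → f i ∈ image f S
∈-image⁺ f                 here        = x∈p∪q⁺ (inj₁ (x∈⁅x⁆ (f zero)))
∈-image⁺ f {inside  ∷ S} (there i∈S) = x∈p∪q⁺ (inj₂ (∈-image⁺ (f ∘ suc) i∈S))
∈-image⁺ f {outside ∷ S} (there i∈S) = ∈-image⁺ (f ∘ suc) i∈S

∈-image⁻ : ∀ {n p} (f : Fin n → Fin p) S {j} → j ∈ image f S → ∃[ i ] (i ∈ S × f i ≡ j)
∈-image⁻ f []            j∈∅ = ⊥-elim (∉⊥ j∈∅)
∈-image⁻ f (inside  ∷ S) j∈f[S] with x∈p∪q⁻ ⁅ f zero ⁆ (image (f ∘ suc) S) j∈f[S]
... | inj₁ j∈⁅f0⁆ = zero , here , sym (x∈⁅y⁆⇒x≡y (f zero) j∈⁅f0⁆)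
... | inj₂ j∈f[S] = map suc (map₁ there) (∈-image⁻ (f ∘ suc) S j∈f[S])
∈-image⁻ f (outside ∷ S) j∈f[S] = map suc (map₁ there) (∈-image⁻ (f ∘ suc) S j∈f[S])

InjectiveOn : ∀ {n p} → (Fin n → Fin p) → Subset n → Set
InjectiveOn f S = ∀ {i j} → i ∈ S → j ∈ S → f i ≡ f j → i ≡ j

InjectiveOn-⊆ : ∀ {n p} {f : Fin n → Fin p} {S T} → T ⊆ S → InjectiveOn f S → InjectiveOn f T
InjectiveOn-⊆ T⊆S inj i∈T j∈T = inj (T⊆S i∈T) (T⊆S j∈T)

drop-∷-InjectiveOn : ∀ {n p s} {f : Fin (suc n) → Fin p} {S} →
  InjectiveOn f (s ∷ S) → InjectiveOn (f ∘ suc) S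
drop-∷-InjectiveOn inj i∈S j∈S e = suc-injective (inj (there i∈S) (there j∈S) e)

sumOver-image : ∀ {n p} (f : Fin n → Fin p) (S : Subset n) (g : Fin p → ℕ) →
  InjectiveOn f S → sumOver (image f S) g ≡ sumOver S (g ∘ f)
sumOver-image f []            g inj = sumOver-∅ _ g
sumOver-image f (inside  ∷ S) g inj = begin
  sumOver (⁅ f zero ⁆ ∪ image (f ∘ suc) S) g            ≡⟨ sumOver-∪ g fresh ⟩
  sumOver ⁅ f zero ⁆ g + sumOver (image (f ∘ suc) S) g  ≡⟨ cong₂ _+_ (sumOver-⁅⁆ (f zero) g)
                                                              (sumOver-image (f ∘ suc) S g (drop-∷-InjectiveOn inj)) ⟩
  g (f zero) + sumOver S (g ∘ f ∘ suc)                  ∎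
  where
  open ≡-Reasoning
  fresh : Disjoint ⁅ f zero ⁆ (image (f ∘ suc) S)
  fresh j∈⁅f0⁆ j∈f[S] with ∈-image⁻ (f ∘ suc) S j∈f[S]
  ... | i , i∈S , f[1+i]≡j =
    0≢1+n (inj here (there i∈S) (trans (sym (x∈⁅y⁆⇒x≡y (f zero) j∈⁅f0⁆)) (sym f[1+i]≡j)))
sumOver-image f (outside ∷ S) g inj = sumOver-image (f ∘ suc) S g (drop-∷-InjectiveOn inj)

∣image∣≡∣p∣ : ∀ {n p} (f : Fin n → Fin p) (S : Subset n) → InjectiveOn f S → ∣ image f S ∣ ≡ ∣ S ∣
∣image∣≡∣p∣ f S inj = begin
  ∣ image f S ∣                  ≡⟨ ∣p∣≡sumOver-1 (image f S) ⟩
  sumOver (image f S) (const 1)  ≡⟨ sumOver-image f S (const 1) inj ⟩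
  sumOver S (const 1)            ≡⟨ ∣p∣≡sumOver-1 S ⟨
  ∣ S ∣                          ∎
  where open ≡-Reasoning

preimage : ∀ {n p} → (Fin n → Fin p) → Subset p → Subset n
preimage f T = tabulate (lookup T ∘ f)

∈-preimage⁺ : ∀ {n p} (f : Fin n → Fin p) {T i} → f i ∈ T → i ∈ preimage f T
∈-preimage⁺ f {T} {i} fi∈T = lookup⇒[]= i _ (trans (lookup∘tabulate (lookup T ∘ f) i) ([]=⇒lookup fi∈T))

∈-preimage⁻ : ∀ {n p} (f : Fin n → Fin p) {T i} → i ∈ preimage f T → f i ∈ T
∈-preimage⁻ f {T} {i} i∈f⁻¹[T] =
  lookup⇒[]= (f i) T (trans (sym (lookup∘tabulate (lookup T ∘ f) i)) ([]=⇒lookup i∈f⁻¹[T]))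

image-∩-preimage : ∀ {n p} (f : Fin n → Fin p) (S : Subset n) {T} → T ⊆ image f S →
  image f (S ∩ preimage f T) ≡ T
image-∩-preimage f S {T} T⊆f[S] = ⊆-antisym ⊆T T⊆
  where
  ⊆T : image f (S ∩ preimage f T) ⊆ T
  ⊆T j∈ with ∈-image⁻ f (S ∩ preimage f T) j∈
  ... | i , i∈S∩f⁻¹[T] , refl = ∈-preimage⁻ f (proj₂ (x∈p∩q⁻ S (preimage f T) i∈S∩f⁻¹[T]))
  T⊆ : T ⊆ image f (S ∩ preimage f T)
  T⊆ j∈T with ∈-image⁻ f S (T⊆f[S] j∈T)
  ... | i , i∈S , refl = ∈-image⁺ f (x∈p∩q⁺ (i∈S , ∈-preimage⁺ f j∈T))

reduce : ∀ {n} p .{{_ : NonZero p}} → Fin n → Fin p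
reduce p i = toℕ i mod p

toℕ≡toℕ-reduce : ∀ {n} p .{{_ : NonZero p}} (i : Fin n) → toℕ i ≡ toℕ (reduce p i) [mod p ]
toℕ≡toℕ-reduce p i = ≡mod-trans (m≡m%n-mod (toℕ i) p) (≡⇒≡mod (sym (toℕ-fromℕ< _)))

DistinctMod : ∀ {n} → ℕ → Subset n → Set
DistinctMod p S = ∀ i j → i ∈ S → j ∈ S → i ≢ j → ¬ (toℕ i ≡ toℕ j [mod p ])

DistinctMod-⊆ : ∀ {n p} {S T : Subset n} → T ⊆ S → DistinctMod p S → DistinctMod p T
DistinctMod-⊆ T⊆S distinct i j i∈T j∈T = distinct i j (T⊆S i∈T) (T⊆S j∈T)

DistinctMod⇒InjectiveOn-reduce : ∀ {n} p .{{_ : NonZero p}} {S : Subset n} →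
  DistinctMod p S → InjectiveOn (reduce p) S
DistinctMod⇒InjectiveOn-reduce p distinct {i} {j} i∈S j∈S e =
  decidable-stable (i ≟ j) (λ i≢j → distinct i j i∈S j∈S i≢j (begin
    toℕ i             ≈⟨ toℕ≡toℕ-reduce p i ⟩
    toℕ (reduce p i)  ≡⟨ cong toℕ e ⟩
    toℕ (reduce p j)  ≈⟨ toℕ≡toℕ-reduce p j ⟨
    toℕ j             ∎))
  where open ≡mod-Reasoning p

Σ≡Σ-image-reduce : ∀ {n} p .{{_ : NonZero p}} (S : Subset n) → InjectiveOn (reduce p) S →
  Σ S ≡ Σ (image (reduce p) S) [mod p ]
Σ≡Σ-image-reduce p S inj = begin
  Σ S                               ≡⟨ Σ≡sumOver S ⟩
  sumOver S toℕ                     ≈⟨ sumOver-cong-mod S (toℕ≡toℕ-reduce p) ⟩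
  sumOver S (toℕ ∘ reduce p)        ≡⟨ sumOver-image (reduce p) S toℕ inj ⟨
  sumOver (image (reduce p) S) toℕ  ≡⟨ Σ≡sumOver (image (reduce p) S) ⟨
  Σ (image (reduce p) S)            ∎
  where open ≡mod-Reasoning p

⊆-image-reduce-lift : ∀ {n} p .{{_ : NonZero p}} (C : Subset n) {A′} →
  InjectiveOn (reduce p) C → A′ ⊆ image (reduce p) C → ∃[ A ] (A ⊆ C × Σ A ≡ Σ A′ [mod p ])
⊆-image-reduce-lift {n} p C {A′} inj A′⊆ = A , p∩q⊆p C _ , (begin
  Σ A                     ≈⟨ Σ≡Σ-image-reduce p A (InjectiveOn-⊆ (p∩q⊆p C _) inj) ⟩
  Σ (image (reduce p) A)  ≡⟨ cong Σ (image-∩-preimage (reduce p) C A′⊆) ⟩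
  Σ A′                    ∎)
  where
  open ≡mod-Reasoning p
  A : Subset n
  A = C ∩ preimage (reduce p) A′

SubsetSumsCover : ℕ → ℕ → Set
SubsetSumsCover p k = (K : Subset p) → ∣ K ∣ ≡ k → (x : Fin p) → ∃[ A ] (A ⊆ K × Σ A ≡ toℕ x [mod p ])

SubsetSumsCover-lift : ∀ {n p k} .{{_ : NonZero p}} → SubsetSumsCover p k →
  (C : Subset n) → ∣ C ∣ ≡ k → DistinctMod p C →
  (x : Fin p) → ∃[ A ] (A ⊆ C × Σ A ≡ toℕ x [mod p ])
SubsetSumsCover-lift {p = p} cover C ∣C∣≡k distinct x =
  let A′ , A′⊆K , ΣA′≡x = cover (image (reduce p) C) (trans (∣image∣≡∣p∣ (reduce p) C inj) ∣C∣≡k) x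
      A , A⊆C , ΣA≡ΣA′ = ⊆-image-reduce-lift p C inj A′⊆K
  in A , A⊆C , ≡mod-trans ΣA≡ΣA′ ΣA′≡x
  where
  inj : InjectiveOn (reduce p) C
  inj = DistinctMod⇒InjectiveOn-reduce p distinct

∃-complementary-subset : ∀ {n p k} .{{_ : NonZero p}} → SubsetSumsCover p k →
  (F : Subset n) → k ≤ ∣ F ∣ → DistinctMod p F →
  ∀ a → ∃[ A ] (A ⊆ F × (Σ A + a) ≡ 0 [mod p ])
∃-complementary-subset {p = p} {k} cover F k≤∣F∣ distinct a =
  let C , C⊆F , ∣C∣≡k = ⊆-of-size k F k≤∣F∣
      x , x+a≡0 = additive-inverse-mod p a
      A , A⊆C , ΣA≡x = SubsetSumsCover-lift cover C ∣C∣≡k (DistinctMod-⊆ C⊆F distinct) x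
  in A , ⊆-trans A⊆C C⊆F , ≡mod-trans (+-cong-mod ΣA≡x ≡mod-refl) x+a≡0

ZeroSumsLift : ∀ {n} → ℕ → ℕ → Subset n → Set
ZeroSumsLift p q B = ¬ (∃[ A ] (A ⊆ B × Σ A ≡ 0 [mod p ] × ¬ (Σ A ≡ 0 [mod q ])))

zero-sum-completion⇒congruent : ∀ {n p q} {A B V₁ V₂ : Subset n} → ZeroSumsLift p q B →
  V₁ ⊆ B → V₂ ⊆ B → A ⊆ B ∩ ∁ (V₁ ∪ V₂) →
  (Σ A + Σ V₁) ≡ 0 [mod p ] → Σ V₁ ≡ Σ V₂ [mod p ] → ¬ ¬ (Σ V₁ ≡ Σ V₂ [mod q ])
zero-sum-completion⇒congruent {p = p} {q} {A} {B} {V₁} {V₂}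
  lift V₁⊆B V₂⊆B A⊆ ΣA+ΣV₁≡0 ΣV₁≡ΣV₂ ΣV₁≢ΣV₂ =
  vanishes V₁⊆B (λ i∈A → A#V₁∪V₂ i∈A ∘ p⊆p∪q V₂) ΣA+ΣV₁≡0 λ ΣA+ΣV₁≡0[q] →
  vanishes V₂⊆B (λ i∈A → A#V₁∪V₂ i∈A ∘ q⊆p∪q V₁ V₂) ΣA+ΣV₂≡0 λ ΣA+ΣV₂≡0[q] →
  ΣV₁≢ΣV₂ (+-cancelˡ-mod (Σ A) (≡mod-trans ΣA+ΣV₁≡0[q] (≡mod-sym ΣA+ΣV₂≡0[q])))
  where
  A#V₁∪V₂ : Disjoint A (V₁ ∪ V₂)
  A#V₁∪V₂ i∈A = x∈∁p⇒x∉p (p∩q⊆q B _ (A⊆ i∈A))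

  vanishes : ∀ {V} → V ⊆ B → Disjoint A V → (Σ A + Σ V) ≡ 0 [mod p ] → ¬ ¬ ((Σ A + Σ V) ≡ 0 [mod q ])
  vanishes {V} V⊆B A#V ≡0 ≢0 = lift
    ( A ∪ V
    , [ p∩q⊆p B _ ∘ A⊆ , V⊆B ]′ ∘ x∈p∪q⁻ A _
    , subst (λ s → s ≡ 0 [mod p ]) (sym (Σ-∪ A#V)) ≡0
    , ≢0 ∘ subst (λ s → s ≡ 0 [mod q ]) (Σ-∪ A#V)
    )

  ΣA+ΣV₂≡0 : (Σ A + Σ V₂) ≡ 0 [mod p ]
  ΣA+ΣV₂≡0 = ≡mod-trans (+-cong-mod (≡mod-refl {Σ A}) (≡mod-sym ΣV₁≡ΣV₂)) ΣA+ΣV₁≡0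

lemma2p2 : (p k : ℕ) → Prime p → 1 ≤ k →
    ((K : Subset p) → ∣ K ∣ ≡ k → (x : Fin p) →
      ∃[ A ] (A ⊆ K × Σ A ≡ toℕ x [mod p ])) →
    (m : ℕ) → 1 < m →
    (B : Subset (m * p)) →
    4 * k < ∣ B ∣ →
    (∀ i j → i ∈ B → j ∈ B → i ≢ j → ¬ (toℕ i ≡ toℕ j [mod p ])) →
    (∃[ b ] (b ∈ B × ¬ (m ∣ toℕ b))) →
    (¬ (∃[ A ] (A ⊆ B × Σ A ≡ 0 [mod p ] × ¬ (Σ A ≡ 0 [mod m * p ])))) →
    (V₁ V₂ : Subset (m * p)) → V₁ ⊆ B → V₂ ⊆ B →
    Σ V₁ ≡ Σ V₂ [mod p ] → ¬ (Σ V₁ ≡ Σ V₂ [mod m * p ]) →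
    (∣ B ∣ ∸ k < ∣ V₁ ∪ V₂ ∣) × (3 * k < ∣ B ∣ ∸ k)
lemma2p2 p k p-prime _ cover m _ B 4k<∣B∣ distinct _ zeroSumsLift
         V₁ V₂ V₁⊆B V₂⊆B ΣV₁≡ΣV₂ ΣV₁≢ΣV₂ =
  decidable-stable (∣ B ∣ ∸ k <? ∣ V₁ ∪ V₂ ∣) union-large , m+n≤o⇒m≤o∸n (suc (3 * k)) 3k+k<∣B∣
  where
  instance
    p≢0 : NonZero p
    p≢0 = prime⇒nonZero p-prime

  3k+k<∣B∣ : 3 * k + k < ∣ B ∣
  3k+k<∣B∣ = subst (_< ∣ B ∣) (+-comm k (3 * k)) 4k<∣B∣

  k≤∣B∣ : k ≤ ∣ B ∣
  k≤∣B∣ = ≤-trans (m≤m+n k (3 * k)) (<⇒≤ 4k<∣B∣)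

  union-large : ¬ ¬ (∣ B ∣ ∸ k < ∣ V₁ ∪ V₂ ∣)
  union-large ≮ =
    let free = B ∩ ∁ (V₁ ∪ V₂)
        k≤∣free∣ = ∣q∣≤∣p∣∸k⇒k≤∣p∩∁q∣ B (V₁ ∪ V₂) k≤∣B∣ (≮⇒≥ ≮)
        A , A⊆free , ΣA+ΣV₁≡0 =
          ∃-complementary-subset cover free k≤∣free∣ (DistinctMod-⊆ (p∩q⊆p B _) distinct) (Σ V₁)
    in zero-sum-completion⇒congruent zeroSumsLift V₁⊆B V₂⊆B A⊆free ΣA+ΣV₁≡0 ΣV₁≡ΣV₂ ΣV₁≢ΣV₂
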